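{- Let $G$ and $H$ be finite, simple, connected graphs, each with at least two vertices. Then $g(G\boxtimes H)\ge 4$.
   Context: For a connected graph, $I[x,y]$ consists of $x$, $y$ and all vertices on some shortest $x$–$y$ path; $I[S]=\bigcup_{u,v\in S}I[u,v]$. $S$ is geodetic if $I[S]$ is the whole vertex set, and $g(\cdot)$ is the minimum cardinality of a geodetic set. The strong product $G\boxtimes H$ has vertex set $V(G)\times V(H)$, with $(g,h)$ and $(g',h')$ adjacent whenever ($g=g'$ and $hh'\in E(H)$), or ($h=h'$ and $gg'\in E(G)$), or ($gg'\in E(G)$ and $hh'\in E(H)$). -}

module Defs where

open import Level using (Level; _⊔_) renaming (suc to lsuc)
open import Data.Nat using (ℕ; zero; suc; _≤_)
open import Data.Fin using (Fin)
open import Data.Product using (Σ; ∃; ∃-syntax; _×_; _,_)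
open import Data.Sum using (_⊎_)
open import Data.List using (List; length)
open import Data.List.Membership.Propositional using (_∈_)
open import Data.List.Relation.Unary.Unique.Propositional using (Unique)
open import Relation.Binary.PropositionalEquality using (_≡_)
open import Relation.Nullary using (¬_)

module _ {V : Set} (E : V → V → Set) where

  data Walk : V → V → ℕ → Set where
    here : ∀ {x} → Walk x x zero
    step : ∀ {x y z k} → E x y → Walk y z k → Walk x z (suc k)

  data OnWalk (w : V) : ∀ {x y k} → Walk x y k → Set where
    at-start : ∀ {y k} (p : Walk w y k) → OnWalk w p
    later    : ∀ {x y z k} (e : E x y) (p : Walk y z k) → OnWalk w p → OnWalk w (step e p)

  Connected : Set
  Connected = ∀ x y → ∃[ k ] Walk x y k

  IsShortest : ∀ {x y k} → Walk x y k → Set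
  IsShortest {x} {y} {k} _ = ∀ j → Walk x y j → k ≤ j

  -- w ∈ I[x,y]: w lies on some shortest x–y path (this includes x and y)
  InInterval : V → V → V → Set
  InInterval x y w = ∃[ k ] Σ (Walk x y k) λ p → IsShortest p × OnWalk w p

  -- S (a duplicate-free list, i.e. a finite set) is geodetic: I[S] = V
  IsGeodetic : List V → Set
  IsGeodetic S = ∀ w → ∃[ u ] ∃[ v ] (u ∈ S × v ∈ S × InInterval u v w)

  GeodeticNumber≥ : ℕ → Set
  GeodeticNumber≥ m = ∀ (S : List V) → Unique S → IsGeodetic S → m ≤ length S

record Graph : Set₁ where
  field
    n      : ℕ
    Adj    : Fin n → Fin n → Set
    sym    : ∀ {x y} → Adj x y → Adj y x
    irrefl : ∀ {x} → ¬ Adj x x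
open Graph public

StrongAdj : (G H : Graph) → (Fin (n G) × Fin (n H)) → (Fin (n G) × Fin (n H)) → Set
StrongAdj G H (g , h) (g' , h') =
    (g ≡ g' × Adj H h h')
  ⊎ (h ≡ h' × Adj G g g')
  ⊎ (Adj G g g' × Adj H h h')

-- In G ⊠ H, a walk projects to no-longer walks in both factors, and
-- factor walks of lengths a and b combine to a product walk of length a ⊔ b;
-- so d((g,h),(g',h')) = max(d_G(g,g'), d_H(h,h')).  Let S ⊆ {u₁,u₂,u₃} with
-- uᵢ = (gᵢ,hᵢ), where u₁u₂ is a farthest pair.  If that distance is 0 the set is
-- a single vertex.  Otherwise, swapping the factors if necessary, it equals
-- D = d_G(g₁,g₂) ≥ d_H(h₁,h₂), and (renaming u₁,u₂ if needed) g₃ ≠ g₂.  Then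
-- w = (g₂,h) with h ≠ h₂, and h = h₃ when h₃ ≠ h₂, lies in no interval I[x,y]
-- with x,y ∈ S: reaching w from u₁ already costs D, and the only remaining
-- pair u₂u₃ either has w behind u₂ (h₃ = h₂) or has w as the corner of the
-- rectangle spanned by u₂ and u₃, where a detour costs a sum instead of a max.

module Submission where

open import Defs renaming (sym to Adj-sym)
open import Data.Nat using (ℕ; zero; suc; _≤_; _<_; _+_; _⊔_; z≤n; s≤s)
open import Data.Nat.Properties
open import Data.Nat.Induction using (<-rec)
open import Data.Fin using (Fin) renaming (zero to fzero; suc to fsuc)
open import Data.Fin.Properties using () renaming (_≟_ to _≟ᶠ_)
open import Data.Product using (∃-syntax; _×_; _,_; proj₁; proj₂; swap)
open import Data.Sum using (_⊎_; inj₁; inj₂)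
open import Data.Empty using (⊥; ⊥-elim)
open import Data.List using (List; []; _∷_; map)
open import Data.List.Membership.Propositional using (_∈_)
open import Data.List.Membership.Propositional.Properties using (∈-map⁺)
open import Data.List.Relation.Unary.Any using (here; there)
open import Data.List.Relation.Binary.Subset.Propositional using (_⊆_)
open import Function using (_∘_)
open import Relation.Binary.Definitions using (Symmetric)
open import Relation.Binary.PropositionalEquality
open import Relation.Nullary using (¬_; yes; no)

module _ {V : Set} (E : V → V → Set) where

  Reach : V → V → ℕ → Set
  Reach x y D = ∃[ m ] (m ≤ D × Walk E x y m)

  Distance : V → V → ℕ → Set
  Distance x y d = Walk E x y d × (∀ {k} → Walk E x y k → d ≤ k)

  -- w ∈ I[x,y] in split form: d(x,w) + d(w,y) ≤ d(x,y), witnessed by walks.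
  record Between (x y w : V) : Set where
    constructor between
    field
      {i j}    : ℕ
      toW      : Walk E x w i
      fromW    : Walk E w y j
      shortest : ∀ {m} → Walk E x y m → i + j ≤ m

  Covers : List V → Set
  Covers S = ∀ w → ∃[ x ] ∃[ y ] (x ∈ S × y ∈ S × Between x y w)

module _ {V : Set} {E : V → V → Set} where

  _++ᵂ_ : ∀ {x y z i j} → Walk E x y i → Walk E y z j → Walk E x z (i + j)
  here       ++ᵂ q = q
  step e p   ++ᵂ q = step e (p ++ᵂ q)

  reverse : Symmetric E → ∀ {x y k} → Walk E x y k → Walk E y x k
  reverse E-sym here = here
  reverse E-sym {k = suc k} (step e p) =
    subst (Walk E _ _) (+-comm k 1) (reverse E-sym p ++ᵂ step (E-sym e) here)

  walk₀⇒≡ : ∀ {x y} → Walk E x y 0 → x ≡ y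
  walk₀⇒≡ here = refl

  reach₀⇒≡ : ∀ {x y} → Reach E x y 0 → x ≡ y
  reach₀⇒≡ (zero , _ , p) = walk₀⇒≡ p

  walk-positive : ∀ {x y k} → x ≢ y → Walk E x y k → 1 ≤ k
  walk-positive {k = zero}  x≢y p = ⊥-elim (x≢y (walk₀⇒≡ p))
  walk-positive {k = suc _} _   _ = s≤s z≤n

  reach-mono : ∀ {x y D D'} → D ≤ D' → Reach E x y D → Reach E x y D'
  reach-mono D≤D' (m , m≤D , p) = m , ≤-trans m≤D D≤D' , p

  reach-reverse : Symmetric E → ∀ {x y D} → Reach E x y D → Reach E y x D
  reach-reverse E-sym (m , m≤D , p) = m , m≤D , reverse E-sym p

  distance⇒reach : ∀ {x y d D} → Distance E x y d → d ≤ D → Reach E x y D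
  distance⇒reach (p , _) d≤D = _ , d≤D , p

  -- Constructively we get it in
  -- continuation form: a minimal length is found by complete induction on the
  -- length of a given walk (this suffices, as all our goals are ⊥).
  withDistance : ∀ {x y k} → Walk E x y k → (∀ d → Distance E x y d → ⊥) → ⊥
  withDistance {x} {y} p noDistance = <-rec (λ j → Walk E x y j → ⊥) noWalk _ p
    where
    noWalk : ∀ j → (∀ {j'} → j' < j → Walk E x y j' → ⊥) → Walk E x y j → ⊥
    noWalk j noShorter q = noDistance j (q , minimal)
      where
      minimal : ∀ {k} → Walk E x y k → j ≤ k
      minimal {k} r with j ≤? k
      ... | yes j≤k = j≤k
      ... | no  j≰k = ⊥-elim (noShorter (≰⇒> j≰k) r)

  splitAt : ∀ {w x y k} {p : Walk E x y k} → OnWalk E w p →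
            ∃[ i ] ∃[ j ] (Walk E x w i × Walk E w y j × i + j ≡ k)
  splitAt (at-start p) = 0 , _ , here , p , refl
  splitAt (later e p w∈p) with splitAt w∈p
  ... | i , j , p₁ , p₂ , i+j≡k = suc i , j , step e p₁ , p₂ , cong suc i+j≡k

  interval⇒between : ∀ {x y w} → InInterval E x y w → Between E x y w
  interval⇒between (k , p , p-shortest , w∈p) with splitAt w∈p
  ... | i , j , p₁ , p₂ , refl = between p₁ p₂ (λ {m} q → p-shortest m q)

  between-sym : Symmetric E → ∀ {x y w} → Between E x y w → Between E y x w
  between-sym E-sym (between {i} {j} p q sh) =
    between (reverse E-sym q) (reverse E-sym p)
            (λ r → ≤-trans (≤-reflexive (+-comm j i)) (sh (reverse E-sym r)))

  -- If every walk from x to w can be traded for a no-longer walk from x to y,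
  -- then w ≠ y is not between x and y: reaching w already costs d(x,y).
  notBetween-farther : ∀ {x y w} → (∀ {k} → Walk E x w k → Reach E x y k) →
                       w ≢ y → ¬ Between E x y w
  notBetween-farther shortcut w≢y (between {i} p q sh) with shortcut p
  ... | m , m≤i , r = <⇒≱ (m<m+n i (walk-positive w≢y q)) (≤-trans (sh r) m≤i)

  notBetween-self : ∀ {x w} → w ≢ x → ¬ Between E x x w
  notBetween-self = notBetween-farther (λ _ → 0 , z≤n , here)

  geodetic⇒covers : ∀ {S} → IsGeodetic E S → Covers E S
  geodetic⇒covers geo w with geo w
  ... | x , y , x∈S , y∈S , w∈I = x , y , x∈S , y∈S , interval⇒between w∈I

  covers-mono : ∀ {S T} → S ⊆ T → Covers E S → Covers E T
  covers-mono S⊆T cov w with cov w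
  ... | x , y , x∈S , y∈S , b = x , y , S⊆T x∈S , S⊆T y∈S , b

  singleton-uncovered : ∀ {x w} → w ≢ x → ¬ Covers E (x ∷ [])
  singleton-uncovered {w = w} w≢x cov with cov w
  ... | _ , _ , here refl , here refl , b = notBetween-self w≢x b

  -- If no three vertices are geodetic, geodetic sets have at least four
  -- vertices: shorter lists are padded to three entries by repetition.
  geodetic≥4 : V → (∀ a b c → ¬ Covers E (a ∷ b ∷ c ∷ [])) → GeodeticNumber≥ E 4
  geodetic≥4 v noTriple [] _ geo with geodetic⇒covers geo v
  ... | _ , _ , () , _
  geodetic≥4 _ noTriple (a ∷ []) _ geo =
    ⊥-elim (noTriple a a a (covers-mono (λ { (here e) → here e }) (geodetic⇒covers geo)))
  geodetic≥4 _ noTriple (a ∷ b ∷ []) _ geo =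
    ⊥-elim (noTriple a b b (covers-mono (λ { (here e) → here e ; (there (here e)) → there (here e) })
                                        (geodetic⇒covers geo)))
  geodetic≥4 _ noTriple (a ∷ b ∷ c ∷ []) _ geo = ⊥-elim (noTriple a b c (geodetic⇒covers geo))
  geodetic≥4 _ _ (_ ∷ _ ∷ _ ∷ _ ∷ _) _ _ = s≤s (s≤s (s≤s (s≤s z≤n)))

mapWalk : {V W : Set} {E : V → V → Set} {F : W → W → Set} (f : V → W) →
          (∀ {a b} → E a b → F (f a) (f b)) → ∀ {x y k} → Walk E x y k → Walk F (f x) (f y) k
mapWalk f f-hom here       = here
mapWalk f f-hom (step e p) = step (f-hom e) (mapWalk f f-hom p)

allPairs : {A : Set} (R : A → A → Set) → Symmetric R → ∀ {a b c} →
           R a a → R b b → R c c → R a b → R a c → R b c →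
           ∀ {x y} → x ∈ a ∷ b ∷ c ∷ [] → y ∈ a ∷ b ∷ c ∷ [] → R x y
allPairs R R-sym aa bb cc ab ac bc = pair
  where
  pair : ∀ {x y} → x ∈ _ → y ∈ _ → R x y
  pair (here refl)                 (here refl)                 = aa
  pair (here refl)                 (there (here refl))         = ab
  pair (here refl)                 (there (there (here refl))) = ac
  pair (there (here refl))         (here refl)                 = R-sym ab
  pair (there (here refl))         (there (here refl))         = bb
  pair (there (here refl))         (there (there (here refl))) = bc
  pair (there (there (here refl))) (here refl)                 = R-sym ac
  pair (there (there (here refl))) (there (here refl))         = R-sym bc
  pair (there (there (here refl))) (there (there (here refl))) = cc

module _ {A : Set} {a b c : A} where
  swap₁₂ : a ∷ b ∷ c ∷ [] ⊆ b ∷ a ∷ c ∷ []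
  swap₁₂ (here e)           = there (here e)
  swap₁₂ (there (here e))   = here e
  swap₁₂ (there (there x∈)) = there (there x∈)

  swap₂₃ : a ∷ b ∷ c ∷ [] ⊆ a ∷ c ∷ b ∷ []
  swap₂₃ (here e)                 = here e
  swap₂₃ (there (here e))         = there (there (here e))
  swap₂₃ (there (there (here e))) = there (here e)

  rotate : a ∷ b ∷ c ∷ [] ⊆ b ∷ c ∷ a ∷ []
  rotate (here e)                 = there (there (here e))
  rotate (there (here e))         = here e
  rotate (there (there (here e))) = there (here e)

another : ∀ {m} → 2 ≤ m → (a : Fin m) → ∃[ b ] b ≢ a
another (s≤s (s≤s _)) fzero    = fsuc fzero , λ ()
another (s≤s (s≤s _)) (fsuc _) = fzero , λ ()

avoid : ∀ {m} → 2 ≤ m → (a b : Fin m) → ∃[ h ] (h ≢ a × (b ≢ a → h ≡ b))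
avoid two a b with b ≟ᶠ a
... | no  b≢a = b , b≢a , λ _ → refl
... | yes b≡a = proj₁ (another two a) , proj₂ (another two a) , λ b≢a → ⊥-elim (b≢a b≡a)

-- 1 ≤ a, 1 ≤ b ⇒ a ⊔ b < a + b: a diagonal route beats a detour.
⊔<+ : ∀ {a b} → 1 ≤ a → 1 ≤ b → a ⊔ b < a + b
⊔<+ {a} {b} 1≤a 1≤b = ⊔-lub (m<m+n a 1≤b) (m<n+m b 1≤a)

largestOfThree : ∀ a b c → (b ≤ a × c ≤ a) ⊎ (a ≤ b × c ≤ b) ⊎ (a ≤ c × b ≤ c)
largestOfThree a b c with ≤-total b a | ≤-total c a | ≤-total c b
... | inj₁ b≤a | inj₁ c≤a | _        = inj₁ (b≤a , c≤a)
... | inj₁ b≤a | inj₂ a≤c | _        = inj₂ (inj₂ (a≤c , ≤-trans b≤a a≤c))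
... | inj₂ a≤b | _        | inj₁ c≤b = inj₂ (inj₁ (a≤b , c≤b))
... | inj₂ a≤b | _        | inj₂ b≤c = inj₂ (inj₂ (≤-trans a≤b b≤c , b≤c))

module _ (G H : Graph) where
  private
    P = StrongAdj G H

  ⊠-sym : Symmetric P
  ⊠-sym (inj₁ (g≡g' , h~h'))        = inj₁ (sym g≡g' , Adj-sym H h~h')
  ⊠-sym (inj₂ (inj₁ (h≡h' , g~g'))) = inj₂ (inj₁ (sym h≡h' , Adj-sym G g~g'))
  ⊠-sym (inj₂ (inj₂ (g~g' , h~h'))) = inj₂ (inj₂ (Adj-sym G g~g' , Adj-sym H h~h'))

  ⊠-swap : ∀ {x y} → P x y → StrongAdj H G (swap x) (swap y)
  ⊠-swap (inj₁ e)        = inj₂ (inj₁ e)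
  ⊠-swap (inj₂ (inj₁ e)) = inj₁ e
  ⊠-swap (inj₂ (inj₂ (g~g' , h~h'))) = inj₂ (inj₂ (h~h' , g~g'))

  projectG : ∀ {x y k} → Walk P x y k → Reach (Adj G) (proj₁ x) (proj₁ y) k
  projectG here = 0 , z≤n , here
  projectG (step (inj₁ (refl , _)) p) with projectG p
  ... | ℓ , ℓ≤k , q = ℓ , m≤n⇒m≤1+n ℓ≤k , q
  projectG (step (inj₂ (inj₁ (_ , g~g'))) p) with projectG p
  ... | ℓ , ℓ≤k , q = suc ℓ , s≤s ℓ≤k , step g~g' q
  projectG (step (inj₂ (inj₂ (g~g' , _))) p) with projectG p
  ... | ℓ , ℓ≤k , q = suc ℓ , s≤s ℓ≤k , step g~g' q

  liftG : ∀ {g g' h a} → Walk (Adj G) g g' a → Walk P (g , h) (g' , h) a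
  liftG = mapWalk (_, _) (λ g~g' → inj₂ (inj₁ (refl , g~g')))

  towardFibre : ∀ {g g' h h' k} → Walk P (g' , h') (g , h) k → Reach P (g' , h') (g , h') k
  towardFibre p with projectG p
  ... | ℓ , ℓ≤k , q = ℓ , ℓ≤k , liftG q

  combine : ∀ {g g' h h' a b} → Walk (Adj G) g g' a → Walk (Adj H) h h' b →
            Walk P (g , h) (g' , h') (a ⊔ b)
  combine here here = here
  combine here (step h~h' q) = step (inj₁ (refl , h~h')) (combine here q)
  combine p@(step _ _) here = liftG p
  combine (step g~g' p) (step h~h' q) = step (inj₂ (inj₂ (g~g' , h~h'))) (combine p q)

  ⊠-connected : Connected (Adj G) → Connected (Adj H) → Connected P
  ⊠-connected cG cH (g , h) (g' , h') = _ , combine (proj₂ (cG g g')) (proj₂ (cH h h'))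

module _ (G H : Graph) where
  private
    P = StrongAdj G H

  projectH : ∀ {x y k} → Walk P x y k → Reach (Adj H) (proj₂ x) (proj₂ y) k
  projectH = projectG H G ∘ mapWalk swap (⊠-swap G H)

  reach-swap : ∀ {x y D} → Reach P x y D → Reach (StrongAdj H G) (swap x) (swap y) D
  reach-swap (m , m≤D , p) = m , m≤D , mapWalk swap (⊠-swap G H) p

  between-swap : ∀ {x y w} → Between P x y w → Between (StrongAdj H G) (swap x) (swap y) (swap w)
  between-swap (between p q sh) =
    between (mapWalk swap (⊠-swap G H) p) (mapWalk swap (⊠-swap G H) q)
            (λ r → sh (mapWalk swap (⊠-swap H G) r))

  covers-swap : ∀ {S} → Covers P S → Covers (StrongAdj H G) (map swap S)
  covers-swap cov w with cov (swap w)
  ... | x , y , x∈S , y∈S , b = swap x , swap y , ∈-map⁺ swap x∈S , ∈-map⁺ swap y∈S , between-swap b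

  -- For g ≠ g' and h ≠ h', the corner (g , h') is not between (g , h) and
  -- (g' , h'): through it one pays d_H(h,h') + d_G(g,g'), diagonally only the max.
  corner-notBetween : ∀ {g g' h h'} → g ≢ g' → h ≢ h' → ¬ Between P (g , h) (g' , h') (g , h')
  corner-notBetween g≢g' h≢h' (between {i} {j} p q sh) with projectH p | projectG G H q
  ... | b , b≤i , pH | a , a≤j , qG =
    <⇒≱ (⊔<+ (walk-positive g≢g' qG) (walk-positive h≢h' pH))
        (≤-trans (≤-trans (+-mono-≤ a≤j b≤i) (≤-reflexive (+-comm j i))) (sh (combine G H qG pH)))

  -- The witness vertex (g₂ , h) is not between u₂ = (g₂ , h₂) and u₃ = (g₃ , h₃):
  -- if h₃ = h₂ it lies behind u₂ as seen from u₃, otherwise it is a corner.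
  notBetween-column : ∀ {g₂ g₃ h₂ h₃ h} → g₃ ≢ g₂ → h ≢ h₂ → (h₃ ≢ h₂ → h ≡ h₃) →
                      ¬ Between P (g₂ , h₂) (g₃ , h₃) (g₂ , h)
  notBetween-column {h₂ = h₂} {h₃} g₃≢g₂ h≢h₂ h-choice with h₃ ≟ᶠ h₂
  ... | yes refl = notBetween-farther (towardFibre G H) (h≢h₂ ∘ cong proj₂) ∘ between-sym (⊠-sym G H)
  ... | no h₃≢h₂ with h-choice h₃≢h₂
  ...   | refl = corner-notBetween (g₃≢g₂ ∘ sym) (h₃≢h₂ ∘ sym)

  farthestInG-uncovered : ∀ {g₁ g₂ g₃ h₁ h₂ h₃ D} → 2 ≤ n H →
    (∀ {ℓ} → Walk (Adj G) g₁ g₂ ℓ → D ≤ ℓ) →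
    Reach P (g₁ , h₁) (g₂ , h₂) D → Reach P (g₁ , h₁) (g₃ , h₃) D →
    g₁ ≢ g₂ → g₃ ≢ g₂ → ¬ Covers P ((g₁ , h₁) ∷ (g₂ , h₂) ∷ (g₃ , h₃) ∷ [])
  farthestInG-uncovered {g₁} {g₂} {h₁ = h₁} {h₂} {h₃} {D} twoH minG r₁₂ r₁₃ g₁≢g₂ g₃≢g₂ cov
    with avoid twoH h₂ h₃
  ... | h , h≢h₂ , h-choice with cov (g₂ , h)
  ...   | _ , _ , x∈S , y∈S , b =
    allPairs (λ x y → ¬ Between P x y (g₂ , h)) (λ ¬b → ¬b ∘ between-sym (⊠-sym G H))
      (notBetween-self (g₁≢g₂ ∘ sym ∘ cong proj₁))
      (notBetween-self (h≢h₂ ∘ cong proj₂))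
      (notBetween-self (g₃≢g₂ ∘ sym ∘ cong proj₁))
      (notBetween-farther (viaD r₁₂) (h≢h₂ ∘ cong proj₂))
      (notBetween-farther (viaD r₁₃) (g₃≢g₂ ∘ sym ∘ cong proj₁))
      (notBetween-column g₃≢g₂ h≢h₂ h-choice)
      x∈S y∈S b
    where
    -- every walk from u₁ to (g₂ , h) has length ≥ D.
    viaD : ∀ {y} → Reach P (g₁ , h₁) y D → ∀ {k} → Walk P (g₁ , h₁) (g₂ , h) k → Reach P (g₁ , h₁) y k
    viaD r p with projectG G H p
    ... | ℓ , ℓ≤k , q = reach-mono (≤-trans (minG q) ℓ≤k) r

  -- Drop the hypothesis g₃ ≠ g₂: if g₃ = g₂ then g₃ ≠ g₁, so exchange u₁ and u₂.
  farthestInG : ∀ {g₁ g₂ g₃ h₁ h₂ h₃ D} → 2 ≤ n H →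
    (∀ {ℓ} → Walk (Adj G) g₁ g₂ ℓ → D ≤ ℓ) →
    Reach P (g₁ , h₁) (g₂ , h₂) D → Reach P (g₁ , h₁) (g₃ , h₃) D → Reach P (g₂ , h₂) (g₃ , h₃) D →
    g₁ ≢ g₂ → ¬ Covers P ((g₁ , h₁) ∷ (g₂ , h₂) ∷ (g₃ , h₃) ∷ [])
  farthestInG {g₂ = g₂} {g₃} twoH minG r₁₂ r₁₃ r₂₃ g₁≢g₂ with g₃ ≟ᶠ g₂
  ... | no g₃≢g₂ = farthestInG-uncovered twoH minG r₁₂ r₁₃ g₁≢g₂ g₃≢g₂
  ... | yes refl =
    farthestInG-uncovered twoH (minG ∘ reverse (Adj-sym G)) (reach-reverse (⊠-sym G H) r₁₂) r₂₃
                          (g₁≢g₂ ∘ sym) (g₁≢g₂ ∘ sym)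
    ∘ covers-mono swap₁₂

  -- A farthest pair at positive distance D whose G-distance a dominates its
  -- H-distance b: then D = a, so the pair is farthest in the G-coordinate.
  farthestDominatedByG : ∀ {g₁ g₂ h₁ h₂ u₃ D a b} → 2 ≤ n H → 1 ≤ D →
    (∀ {k} → Walk P (g₁ , h₁) (g₂ , h₂) k → D ≤ k) →
    Reach P (g₁ , h₁) u₃ D → Reach P (g₂ , h₂) u₃ D →
    Distance (Adj G) g₁ g₂ a → Walk (Adj H) h₁ h₂ b → b ≤ a →
    ¬ Covers P ((g₁ , h₁) ∷ (g₂ , h₂) ∷ u₃ ∷ [])
  farthestDominatedByG {D = D} {a} {b} twoH 1≤D minP r₁₃ r₂₃ (pG , minG) pH b≤a =
    farthestInG twoH minG (_ , ≤-reflexive a⊔b≡a , combine G H pG pH)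
                (reach-mono D≤a r₁₃) (reach-mono D≤a r₂₃) g₁≢g₂
    where
    a⊔b≡a : a ⊔ b ≡ a
    a⊔b≡a = m≥n⇒m⊔n≡m b≤a
    D≤a : D ≤ a
    D≤a = ≤-trans (minP (combine G H pG pH)) (≤-reflexive a⊔b≡a)
    g₁≢g₂ : _ ≢ _
    g₁≢g₂ refl = <⇒≱ (≤-trans 1≤D D≤a) (minG here)

module _ (G H : Graph) (twoG : 2 ≤ n G) (twoH : 2 ≤ n H) where
  private
    P = StrongAdj G H

  farthestPair : ∀ {u₁ u₂ u₃ d} → Distance P u₁ u₂ d → Reach P u₁ u₃ d → Reach P u₂ u₃ d →
                 ¬ Covers P (u₁ ∷ u₂ ∷ u₃ ∷ [])
  -- At distance 0 all three vertices coincide.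
  farthestPair {g₁ , h₁} {d = zero} (p , _) r₁₃ _ with walk₀⇒≡ p | reach₀⇒≡ r₁₃
  ... | refl | refl with another twoH h₁
  ...   | h , h≢h₁ = singleton-uncovered {w = g₁ , h} (h≢h₁ ∘ cong proj₂) ∘ covers-mono collapse
    where
    collapse : ∀ {x : Fin (n G) × Fin (n H)} → x ∷ x ∷ x ∷ [] ⊆ x ∷ []
    collapse (here e)                 = here e
    collapse (there (here e))         = here e
    collapse (there (there (here e))) = here e
  farthestPair {d = suc _} (p , minP) r₁₃ r₂₃ cov =
    withDistance (proj₂ (proj₂ (projectG G H p))) λ a distG →
    withDistance (proj₂ (proj₂ (projectH G H p))) λ b distH →
    dominant a b distG distH (≤-total b a)
    where
    -- the distance of the pair is attained in the factor with the larger distance;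
    -- if that is H, swap the factors.
    dominant : ∀ a b → Distance (Adj G) _ _ a → Distance (Adj H) _ _ b → b ≤ a ⊎ a ≤ b → ⊥
    dominant a b distG distH (inj₁ b≤a) =
      farthestDominatedByG G H twoH (s≤s z≤n) minP r₁₃ r₂₃ distG (proj₁ distH) b≤a cov
    dominant a b distG distH (inj₂ a≤b) =
      farthestDominatedByG H G twoG (s≤s z≤n) (minP ∘ mapWalk swap (⊠-swap H G))
        (reach-swap G H r₁₃) (reach-swap G H r₂₃) distH (proj₁ distG) a≤b (covers-swap G H cov)

  -- Whichever of the three pairwise distances is largest, permute to make it d(u₁,u₂).
  noCoveringTriple : Connected (Adj G) → Connected (Adj H) →
                     ∀ u₁ u₂ u₃ → ¬ Covers P (u₁ ∷ u₂ ∷ u₃ ∷ [])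
  noCoveringTriple cG cH u₁ u₂ u₃ cov =
    withDistance (walk u₁ u₂) λ d₁₂ D₁₂ →
    withDistance (walk u₁ u₃) λ d₁₃ D₁₃ →
    withDistance (walk u₂ u₃) λ d₂₃ D₂₃ →
    largest D₁₂ D₁₃ D₂₃ (largestOfThree d₁₂ d₁₃ d₂₃)
    where
    walk : ∀ x y → Walk P x y _
    walk x y = proj₂ (⊠-connected G H cG cH x y)
    rev : ∀ {x y D} → Reach P x y D → Reach P y x D
    rev = reach-reverse (⊠-sym G H)
    largest : ∀ {d₁₂ d₁₃ d₂₃} → Distance P u₁ u₂ d₁₂ → Distance P u₁ u₃ d₁₃ → Distance P u₂ u₃ d₂₃ →
              (d₁₃ ≤ d₁₂ × d₂₃ ≤ d₁₂) ⊎ (d₁₂ ≤ d₁₃ × d₂₃ ≤ d₁₃) ⊎ (d₁₂ ≤ d₂₃ × d₁₃ ≤ d₂₃) → ⊥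
    largest D₁₂ D₁₃ D₂₃ (inj₁ (≤d₁₂ , ≤d₁₂')) =
      farthestPair D₁₂ (distance⇒reach D₁₃ ≤d₁₂) (distance⇒reach D₂₃ ≤d₁₂') cov
    largest D₁₂ D₁₃ D₂₃ (inj₂ (inj₁ (≤d₁₃ , ≤d₁₃'))) =
      farthestPair D₁₃ (distance⇒reach D₁₂ ≤d₁₃) (rev (distance⇒reach D₂₃ ≤d₁₃'))
        (covers-mono swap₂₃ cov)
    largest D₁₂ D₁₃ D₂₃ (inj₂ (inj₂ (≤d₂₃ , ≤d₂₃'))) =
      farthestPair D₂₃ (rev (distance⇒reach D₁₂ ≤d₂₃)) (rev (distance⇒reach D₁₃ ≤d₂₃'))
        (covers-mono rotate cov)

proposition3 : (G H : Graph)
    → 2 ≤ n G → 2 ≤ n H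
    → Connected (Adj G) → Connected (Adj H)
    → GeodeticNumber≥ (StrongAdj G H) 4
proposition3 G H twoG twoH cG cH =
  geodetic≥4 (vertex twoG , vertex twoH) (noCoveringTriple G H twoG twoH cG cH)
  where
  vertex : ∀ {m} → 2 ≤ m → Fin m
  vertex (s≤s _) = fzero
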